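{- Let $p>3$ be a prime. Then $$\left(\frac{p-1}{2}\right)!!\prod_{\substack{i,j=1\\ p\nmid 2i+j}}^{(p-1)/2}(2i+j)\equiv\left(\frac{ -2}{p}\right)\left(\frac{p-3}{2}\right)!!\prod_{\substack{i,j=1\\ p\nmid 2i-j}}^{(p-1)/2}(2i-j)\equiv\pm1\pmod p.$$
   Context: For a positive integer $n$, $n!!=\prod_{k=0}^{\lfloor(n-1)/2\rfloor}(n-2k)$. $\left(\frac{\cdot}{p}\right)$ is the Legendre symbol. -}

module Defs where

open import Data.Nat as ℕ using (ℕ; zero; suc)
open import Data.Integer as ℤ using (ℤ; +_; -_; _-_; ∣_∣)
open import Data.Integer.Divisibility using () renaming (_∣_ to _∣ℤ_)
open import Data.Nat.Divisibility using (_∣?_)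
open import Data.List using (List; []; _∷_; map; upTo)
open import Data.Bool.ListAction using (any)
open import Data.Bool using (Bool; true; false; if_then_else_)
open import Relation.Nullary.Decidable using (does)

_!! : ℕ → ℕ
zero !! = 1
suc zero !! = 1
suc (suc n) !! = suc (suc n) ℕ.* (n !!)

_≡_[mod_] : ℤ → ℤ → ℕ → Set
a ≡ b [mod m ] = (+ m) ∣ℤ (a - b)

divides? : ℕ → ℤ → Bool
divides? p a = does (p ∣? ∣ a ∣)

isSquareMod : ℤ → ℕ → Bool
isSquareMod a p = any (λ x → divides? p ((+ x) ℤ.* (+ x) - a)) (upTo p)

legendre : ℤ → ℕ → ℤ
legendre a p = if divides? p a then + 0 else (if isSquareMod a p then + 1 else - (+ 1))

prodFrom1 : ℕ → (ℕ → ℤ) → ℤ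
prodFrom1 zero f = + 1
prodFrom1 (suc n) f = prodFrom1 n f ℤ.* f (suc n)

prodCoprime : ℕ → ℕ → (ℕ → ℕ → ℤ) → ℤ
prodCoprime p n g =
  prodFrom1 n (λ i → prodFrom1 n (λ j → if divides? p (g i j) then + 1 else g i j))

LHS61 : ℕ → ℤ
LHS61 p = (+ (((p ℕ.∸ 1) ℕ./ 2) !!)) ℤ.* prodCoprime p ((p ℕ.∸ 1) ℕ./ 2) (λ i j → + (2 ℕ.* i) ℤ.+ + j)

RHS61 : ℕ → ℤ
RHS61 p = (legendre (- (+ 2)) p ℤ.* + (((p ℕ.∸ 3) ℕ./ 2) !!)) ℤ.* prodCoprime p ((p ℕ.∸ 1) ℕ./ 2) (λ i j → + (2 ℕ.* i) - + j)

{-# OPTIONS --safe #-}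
-- Write p = 2h + 1 and call L and R the two sides. For 1 ≤ i ≤ h, the i-th rows of the two products,
-- ∏ⱼ (2i − j) and ∏ⱼ (2i + j), together with 2i are p consecutive integers; with the multiple of p
-- skipped they run through the units mod p, so each such window has product (p − 1)! ≡ −1 (Wilson).
-- Multiplying the windows, L · R′ · 2^h ≡ (−1)^h for R′ = ((p − 3)/2)!! ∏ (2i − j), and Euler's
-- criterion (−2)^h ≡ (−2/p) turns this into L · R ≡ 1. If h = 2m, pairing row i with row m + i of L
-- gives windows again, so L ≡ (−1)^m; if h = 2m + 1, row m + 1 of R′ is h! and row m + 1 + i is row i
-- of L reversed, so R′ ≡ ±h!, and h!² ≡ (−1)^(h+1) = 1. Either way L² ≡ 1 or R² ≡ 1, whence L ≡ R
-- and R² ≡ 1, i.e. R ≡ ±1. Wilson's theorem and Euler's criterion come from pairing every unit x with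
-- the residue of a/x, which is a fixed-point-free involution exactly when a is a non-residue.

module Submission where

open import Defs
open import Data.Nat using (ℕ; _>_)
open import Data.Nat.Primality using (Prime)
open import Data.Integer using (+_; -_)
open import Data.Product using (_×_)
open import Data.Sum using (_⊎_)

open import Data.Bool using (true; false; if_then_else_; T)
open import Data.Nat as ℕ using (zero; suc; _!)
import Data.Nat.Properties as ℕP
import Data.Nat.Divisibility as ℕ∣
open import Data.Nat.DivMod using (m*n/n≡m)
open import Data.Nat.GCD using (module Bézout; module GCD)
open import Data.Nat.Coprimality using (prime⇒coprime; coprime⇒GCD≡1)
open import Data.Nat.Primality using (euclidsLemma; ¬prime[1]; prime⇒irreducible)
open import Data.Nat.Induction using (<-wellFounded)
open import Data.Nat.ListAction using (product)
open import Data.Nat.ListAction.Properties using (product-↭)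
open import Data.Nat.Tactic.RingSolver using () renaming (solve-∀ to ℕ-solve-∀)
open import Data.Integer as ℤ using (ℤ; _+_; _*_; _-_; _^_; -[1+_]; ∣_∣)
import Data.Integer.Properties as ℤP
open import Data.Integer.Divisibility.Signed as ℤ∣ using (divides)
open import Data.Integer.DivMod using (a≡a%ℕn+[a/ℕn]*n; n%ℕd<d)
open import Data.Integer.Tactic.RingSolver using (solve-∀)
open import Data.List using (List; []; _∷_; length; filter; applyDownFrom; upTo)
open import Data.List.Properties using (filter-all; filter-accept; filter-reject; length-applyDownFrom)
open import Data.List.Membership.Propositional using (_∈_; find; lose)
open import Data.List.Membership.Propositional.Properties
  using (∈-filter⁺; ∈-filter⁻; ∈-applyDownFrom⁺; ∈-applyDownFrom⁻; ∈-upTo⁺; ∈-upTo⁻)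
open import Data.List.Relation.Unary.Any using (here; there)
open import Data.List.Relation.Unary.Any.Properties using (any⁺; any⁻)
import Data.List.Relation.Unary.All as All
open import Data.List.Relation.Unary.AllPairs using (_∷_)
open import Data.List.Relation.Unary.Unique.Propositional using (Unique)
open import Data.List.Relation.Unary.Unique.Propositional.Properties using (filter⁺; applyDownFrom⁺₁)
open import Data.List.Relation.Binary.Permutation.Propositional
  using (_↭_; ↭-reflexive; ↭-refl; ↭-trans; ↭-prep; ↭-swap)
open import Data.List.Relation.Binary.Permutation.Propositional.Properties using (↭-length)
open import Data.Product using (_,_; ∃; proj₁; proj₂)
open import Data.Sum using (inj₁; inj₂; [_,_]′)
open import Function using (_∘_)
open import Induction.WellFounded using (Acc; acc)
open import Relation.Nullary using (¬_; ¬?; yes; no; contradiction)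
open import Relation.Nullary.Decidable using (dec-true; dec-false)
open import Relation.Binary.Bundles using (Setoid)
import Relation.Binary.Reasoning.Setoid as SetoidReasoning
open import Relation.Binary.PropositionalEquality

∏ : ℕ → (ℕ → ℤ) → ℤ
∏ = prodFrom1

∏-cong : ∀ n {f g : ℕ → ℤ} → (∀ k → k ℕ.< n → f (suc k) ≡ g (suc k)) → ∏ n f ≡ ∏ n g
∏-cong zero      eq = refl
∏-cong (suc n)   eq = cong₂ _*_ (∏-cong n (λ k k<n → eq k (ℕP.m<n⇒m<1+n k<n))) (eq n ℕP.≤-refl)

∏-* : ∀ n (f g : ℕ → ℤ) → ∏ n (λ k → f k * g k) ≡ ∏ n f * ∏ n g
∏-* zero    f g = refl
∏-* (suc n) f g rewrite ∏-* n f g = interchange (∏ n f) (∏ n g) (f (suc n)) (g (suc n))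
  where interchange : ∀ a b c d → a * b * (c * d) ≡ a * c * (b * d)
        interchange = solve-∀

∏-const : ∀ n c → ∏ n (λ _ → c) ≡ c ^ n
∏-const zero    c = refl
∏-const (suc n) c rewrite ∏-const n c = ℤP.*-comm (c ^ n) c

∏-suc : ∀ n (f : ℕ → ℤ) → ∏ (suc n) f ≡ f 1 * ∏ n (λ k → f (suc k))
∏-suc zero    f = ℤP.*-comm (+ 1) (f 1)
∏-suc (suc n) f rewrite ∏-suc n f = ℤP.*-assoc (f 1) _ _

∏-+ : ∀ m n (f : ℕ → ℤ) → ∏ (m ℕ.+ n) f ≡ ∏ m f * ∏ n (λ k → f (m ℕ.+ k))
∏-+ m zero    f rewrite ℕP.+-identityʳ m = sym (ℤP.*-identityʳ _)
∏-+ m (suc n) f rewrite ℕP.+-suc m n | ∏-+ m n f = ℤP.*-assoc (∏ m f) _ _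

∏-reverse : ∀ n (f : ℕ → ℤ) → ∏ n f ≡ ∏ n (λ k → f (suc n ℕ.∸ k))
∏-reverse zero    f = refl
∏-reverse (suc n) f = begin
  ∏ n f * f (suc n)                              ≡⟨ cong (_* f (suc n)) (∏-reverse n f) ⟩
  ∏ n (λ k → f (suc n ℕ.∸ k)) * f (suc n)        ≡⟨ ℤP.*-comm _ (f (suc n)) ⟩
  f (suc n) * ∏ n (λ k → f (suc n ℕ.∸ k))        ≡⟨ ∏-suc n (λ k → f (suc (suc n) ℕ.∸ k)) ⟨
  ∏ (suc n) (λ k → f (suc (suc n) ℕ.∸ k))        ∎
  where open ≡-Reasoning

+[1+n]≡+[n∸k]++[1+k] : ∀ {n k} → k ℕ.< n → + suc n ≡ + (n ℕ.∸ k) + + suc k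
+[1+n]≡+[n∸k]++[1+k] {n} {k} k<n =
  trans (cong (λ t → + suc t) (sym (ℕP.m∸n+n≡m (ℕP.<⇒≤ k<n))))
        (trans (cong +_ (sym (ℕP.+-suc (n ℕ.∸ k) k))) (ℤP.pos-+ (n ℕ.∸ k) (suc k)))

∏-shift-+ : ∀ (f : ℤ → ℤ) a k l →
            ∏ (k ℕ.+ l) (λ i → f (a + + i)) ≡ ∏ k (λ i → f (a + + i)) * ∏ l (λ i → f (a + + k + + i))
∏-shift-+ f a k l = trans (∏-+ k l (λ i → f (a + + i))) (cong (∏ k (λ i → f (a + + i)) *_) (∏-cong l regroup))
  where regroup : ∀ i → i ℕ.< l → f (a + + (k ℕ.+ suc i)) ≡ f (a + + k + + suc i)
        regroup i _ = cong f (trans (cong (λ z → a + z) (ℤP.pos-+ k (suc i))) (sym (ℤP.+-assoc a (+ k) (+ suc i))))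

∏-centred : ∀ (f : ℤ → ℤ) b n →
            ∏ (n ℕ.+ suc n) (λ i → f (b - + suc n + + i)) ≡ ∏ n (λ j → f (b - + j)) * f b * ∏ n (λ j → f (b + + j))
∏-centred f b n = begin
  ∏ (n ℕ.+ suc n) F                                    ≡⟨ ∏-+ n (suc n) F ⟩
  ∏ n F * ∏ (suc n) (λ k → F (n ℕ.+ k))                ≡⟨ cong (∏ n F *_) (∏-suc n (λ k → F (n ℕ.+ k))) ⟩
  ∏ n F * (F (n ℕ.+ 1) * ∏ n (λ k → F (n ℕ.+ suc k)))  ≡⟨ ℤP.*-assoc (∏ n F) _ _ ⟨
  ∏ n F * F (n ℕ.+ 1) * ∏ n (λ k → F (n ℕ.+ suc k))    ≡⟨ cong₂ _*_ (cong₂ _*_ lower (cong f centre)) upper ⟩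
  ∏ n (λ j → f (b - + j)) * f b * ∏ n (λ j → f (b + + j)) ∎
  where
    open ≡-Reasoning
    F : ℕ → ℤ
    F i = f (b - + suc n + + i)
    lower : ∏ n F ≡ ∏ n (λ j → f (b - + j))
    lower = trans (∏-reverse n F) (∏-cong n (λ k k<n → cong f (begin
      b - + suc n + + (n ℕ.∸ k)                   ≡⟨ cong (λ z → b - z + + (n ℕ.∸ k)) (+[1+n]≡+[n∸k]++[1+k] k<n) ⟩
      b - (+ (n ℕ.∸ k) + + suc k) + + (n ℕ.∸ k)   ≡⟨ e b (+ (n ℕ.∸ k)) (+ suc k) ⟩
      b - + suc k                                 ∎)))
      where e : ∀ b x y → b - (x + y) + x ≡ b - y
            e = solve-∀
    centre : b - + suc n + + (n ℕ.+ 1) ≡ b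
    centre = trans (cong (λ z → b - + suc n + + z) (ℕP.+-comm n 1)) (e b (+ suc n))
      where e : ∀ b s → b - s + s ≡ b
            e = solve-∀
    upper : ∏ n (λ k → F (n ℕ.+ suc k)) ≡ ∏ n (λ j → f (b + + j))
    upper = ∏-cong n (λ k _ → cong f (begin
      b - + suc n + + (n ℕ.+ suc (suc k))        ≡⟨ cong (λ z → b - + suc n + z) (cong +_ (ℕP.+-suc n (suc k))) ⟩
      b - + suc n + + (suc n ℕ.+ suc k)          ≡⟨ cong (λ z → b - + suc n + z) (ℤP.pos-+ (suc n) (suc k)) ⟩
      b - + suc n + (+ suc n + + suc k)          ≡⟨ e b (+ suc n) (+ suc k) ⟩
      b + + suc k                                ∎))
      where e : ∀ b s k → b - s + (s + k) ≡ b + k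
            e = solve-∀

∏-reflect : ∀ (f : ℤ → ℤ) b n → ∏ n (λ j → f (b + + suc n - + j)) ≡ ∏ n (λ j → f (b + + j))
∏-reflect f b n = trans (∏-reverse n (λ j → f (b + + suc n - + j))) (∏-cong n reflected)
  where
    reflected : ∀ k → k ℕ.< n → f (b + + suc n - + (n ℕ.∸ k)) ≡ f (b + + suc k)
    reflected k k<n =
      cong f (trans (cong (λ t → b + t - + (n ℕ.∸ k)) (+[1+n]≡+[n∸k]++[1+k] k<n)) (e b (+ (n ℕ.∸ k)) (+ suc k)))
      where e : ∀ b x y → b + (x + y) - x ≡ b + y
            e = solve-∀

∏-id : ∀ n → ∏ n (λ k → + k) ≡ + (n !)
∏-id zero    = refl
∏-id (suc n) = begin
  ∏ n (λ k → + k) * + suc n    ≡⟨ cong (_* + suc n) (∏-id n) ⟩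
  + (n !) * + suc n            ≡⟨ ℤP.pos-* (n !) (suc n) ⟨
  + (n ! ℕ.* suc n)            ≡⟨ cong +_ (ℕP.*-comm (n !) (suc n)) ⟩
  + (suc n !)                  ∎
  where open ≡-Reasoning

∏2i≡2^n*n! : ∀ n → ∏ n (λ i → + (2 ℕ.* i)) ≡ (+ 2) ^ n * + (n !)
∏2i≡2^n*n! n = begin
  ∏ n (λ i → + (2 ℕ.* i))              ≡⟨ ∏-cong n (λ k _ → ℤP.pos-* 2 (suc k)) ⟩
  ∏ n (λ i → + 2 * + i)                ≡⟨ ∏-* n (λ _ → + 2) (λ k → + k) ⟩
  ∏ n (λ _ → + 2) * ∏ n (λ k → + k)    ≡⟨ cong₂ _*_ (∏-const n (+ 2)) (∏-id n) ⟩
  (+ 2) ^ n * + (n !)                  ∎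
  where open ≡-Reasoning

∏2i≡[2n]!! : ∀ n → ∏ n (λ i → + (2 ℕ.* i)) ≡ + ((2 ℕ.* n) !!)
∏2i≡[2n]!! zero    = refl
∏2i≡[2n]!! (suc n) = begin
  ∏ n (λ i → + (2 ℕ.* i)) * + (2 ℕ.* suc n)     ≡⟨ cong₂ _*_ (∏2i≡[2n]!! n) (cong +_ (ℕP.*-suc 2 n)) ⟩
  + ((2 ℕ.* n) !!) * + (2 ℕ.+ 2 ℕ.* n)          ≡⟨ ℤP.*-comm (+ ((2 ℕ.* n) !!)) _ ⟩
  + (2 ℕ.+ 2 ℕ.* n) * + ((2 ℕ.* n) !!)          ≡⟨ ℤP.pos-* (2 ℕ.+ 2 ℕ.* n) ((2 ℕ.* n) !!) ⟨
  + ((2 ℕ.+ 2 ℕ.* n) !!)                        ≡⟨ cong (λ m → + (m !!)) (ℕP.*-suc 2 n) ⟨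
  + ((2 ℕ.* suc n) !!)                          ∎
  where open ≡-Reasoning

n!!*[n∸1]!!≡n! : ∀ n → n !! ℕ.* (n ℕ.∸ 1) !! ≡ n !
n!!*[n∸1]!!≡n! zero          = refl
n!!*[n∸1]!!≡n! (suc zero)    = refl
n!!*[n∸1]!!≡n! (suc (suc n)) = begin
  (2 ℕ.+ n) ℕ.* n !! ℕ.* suc n !!      ≡⟨ ℕP.*-assoc (2 ℕ.+ n) (n !!) (suc n !!) ⟩
  (2 ℕ.+ n) ℕ.* (n !! ℕ.* suc n !!)    ≡⟨ cong ((2 ℕ.+ n) ℕ.*_) (ℕP.*-comm (n !!) (suc n !!)) ⟩
  (2 ℕ.+ n) ℕ.* (suc n !! ℕ.* n !!)    ≡⟨ cong ((2 ℕ.+ n) ℕ.*_) (n!!*[n∸1]!!≡n! (suc n)) ⟩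
  (2 ℕ.+ n) ℕ.* suc n !                ∎
  where open ≡-Reasoning

^-distribʳ-* : ∀ a b n → (a * b) ^ n ≡ a ^ n * b ^ n
^-distribʳ-* a b zero    = refl
^-distribʳ-* a b (suc n) rewrite ^-distribʳ-* a b n = e a b (a ^ n) (b ^ n)
  where e : ∀ a b x y → a * b * (x * y) ≡ a * x * (b * y)
        e = solve-∀

[-1]^n*[-1]^n≡1 : ∀ n → (- + 1) ^ n * (- + 1) ^ n ≡ + 1
[-1]^n*[-1]^n≡1 n = trans (sym (^-distribʳ-* (- + 1) (- + 1) n)) (ℤP.^-zeroˡ n)

[-1]^2n≡1 : ∀ n → (- + 1) ^ (2 ℕ.* n) ≡ + 1
[-1]^2n≡1 n = trans (cong ((- + 1) ^_) (cong (n ℕ.+_) (ℕP.+-identityʳ n)))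
                    (trans (ℤP.^-distribˡ-+-* (- + 1) n n) ([-1]^n*[-1]^n≡1 n))

even-or-odd : ∀ n → ∃ λ m → n ≡ 2 ℕ.* m ⊎ n ≡ suc (2 ℕ.* m)
even-or-odd zero = 0 , inj₁ refl
even-or-odd (suc n) with even-or-odd n
... | m , inj₁ n≡2m   = m , inj₂ (cong suc n≡2m)
... | m , inj₂ n≡1+2m = suc m , inj₁ (trans (cong suc n≡1+2m) (sym (ℕP.*-suc 2 m)))

without : ℕ → List ℕ → List ℕ
without y = filter (λ x → ¬? (x ℕP.≟ y))

↭-without : ∀ {y xs} → Unique xs → y ∈ xs → xs ↭ y ∷ without y xs
↭-without {y} {y ∷ xs} (y∉xs ∷ _) (here refl) =
  ↭-reflexive (cong (y ∷_) (sym (trans (filter-reject (λ x → ¬? (x ℕP.≟ y)) (λ y≢y → y≢y refl))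
                                       (filter-all (λ x → ¬? (x ℕP.≟ y)) (All.map ≢-sym y∉xs)))))
↭-without {y} {x ∷ xs} (x∉xs ∷ u) (there y∈xs) =
  subst (x ∷ xs ↭_) (cong (y ∷_) (sym (filter-accept (λ z → ¬? (z ℕP.≟ y)) (All.lookup x∉xs y∈xs))))
        (↭-trans (↭-prep x (↭-without u y∈xs)) (↭-swap x y ↭-refl))

∈-without⁺ : ∀ {y z xs} → z ∈ xs → z ≢ y → z ∈ without y xs
∈-without⁺ {y} = ∈-filter⁺ (λ x → ¬? (x ℕP.≟ y))

∈-without⁻ : ∀ {y z} xs → z ∈ without y xs → z ∈ xs × z ≢ y
∈-without⁻ {y} xs = ∈-filter⁻ (λ x → ¬? (x ℕP.≟ y)) {xs = xs}

product-applyDownFrom-suc : ∀ n → product (applyDownFrom suc n) ≡ n !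
product-applyDownFrom-suc zero    = refl
product-applyDownFrom-suc (suc n) = cong (suc n ℕ.*_) (product-applyDownFrom-suc n)

module Congruence (m : ℕ) where

  -- A record, unlike _≡_[mod_] of Defs, keeps a and b inferable from a proof of a ≈ b.
  infix 4 _≈_
  record _≈_ (a b : ℤ) : Set where
    constructor mk≈
    field divides-difference : + m ℤ∣.∣ a - b

  ≈⇒≡[mod] : ∀ {a b} → a ≈ b → a ≡ b [mod m ]
  ≈⇒≡[mod] (mk≈ m∣a-b) = ℤ∣.∣⇒∣ᵤ m∣a-b

  ≈-refl : ∀ {a} → a ≈ a
  ≈-refl {a} = mk≈ (divides (+ 0) (trans (ℤP.+-inverseʳ a) (sym (ℤP.*-zeroˡ (+ m)))))

  ≈-reflexive : ∀ {a b} → a ≡ b → a ≈ b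
  ≈-reflexive refl = ≈-refl

  private
    ∣-resp : ∀ {a b} → a ≡ b → + m ℤ∣.∣ a → + m ℤ∣.∣ b
    ∣-resp = subst (+ m ℤ∣.∣_)

  ≈-sym : ∀ {a b} → a ≈ b → b ≈ a
  ≈-sym {a} {b} (mk≈ d) = mk≈ (∣-resp (e a b) (ℤ∣.∣m⇒∣-m d))
    where e : ∀ a b → - (a - b) ≡ b - a
          e = solve-∀

  ≈-trans : ∀ {a b c} → a ≈ b → b ≈ c → a ≈ c
  ≈-trans {a} {b} {c} (mk≈ d) (mk≈ d′) = mk≈ (∣-resp (e a b c) (ℤ∣.∣m∣n⇒∣m+n d d′))
    where e : ∀ a b c → (a - b) + (b - c) ≡ a - c
          e = solve-∀

  ≈-setoid : Setoid _ _
  ≈-setoid = record { Carrier = ℤ ; _≈_ = _≈_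
                    ; isEquivalence = record { refl = ≈-refl ; sym = ≈-sym ; trans = ≈-trans } }

  module ≈-Reasoning = SetoidReasoning ≈-setoid

  *-cong : ∀ {a b c d} → a ≈ b → c ≈ d → a * c ≈ b * d
  *-cong {a} {b} {c} {d} (mk≈ x) (mk≈ y) =
    mk≈ (∣-resp (e a b c d) (ℤ∣.∣m∣n⇒∣m+n (ℤ∣.∣m⇒∣m*n c x) (ℤ∣.∣n⇒∣m*n b y)))
    where e : ∀ a b c d → (a - b) * c + b * (c - d) ≡ a * c - b * d
          e = solve-∀

  *-congˡ : ∀ a {c d} → c ≈ d → a * c ≈ a * d
  *-congˡ a = *-cong (≈-refl {a})

  *-congʳ : ∀ c {a b} → a ≈ b → a * c ≈ b * c
  *-congʳ c a≈b = *-cong a≈b (≈-refl {c})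

  -‿cong : ∀ {a b} → a ≈ b → - a ≈ - b
  -‿cong {a} {b} (mk≈ d) = mk≈ (∣-resp (e a b) (ℤ∣.∣m⇒∣-m d))
    where e : ∀ a b → - (a - b) ≡ - a - - b
          e = solve-∀

  ^-congˡ : ∀ {a b} n → a ≈ b → a ^ n ≈ b ^ n
  ^-congˡ zero    _   = ≈-refl
  ^-congˡ (suc n) a≈b = *-cong a≈b (^-congˡ n a≈b)

  ∏-cong≈ : ∀ n {f g : ℕ → ℤ} → (∀ k → k ℕ.< n → f (suc k) ≈ g (suc k)) → ∏ n f ≈ ∏ n g
  ∏-cong≈ zero    eq = ≈-refl
  ∏-cong≈ (suc n) eq = *-cong (∏-cong≈ n (λ k k<n → eq k (ℕP.m<n⇒m<1+n k<n))) (eq n ℕP.≤-refl)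

  +-multiple : ∀ a k → a + k * + m ≈ a
  +-multiple a k = mk≈ (divides k (e a k (+ m)))
    where e : ∀ a k m → (a + k * m) - a ≡ k * m
          e = solve-∀

  ≈-resp-∣ : ∀ {a b} → a ≈ b → + m ℤ∣.∣ a → + m ℤ∣.∣ b
  ≈-resp-∣ {a} {b} (mk≈ d) m∣a = subst (+ m ℤ∣.∣_) (e a b) (ℤ∣.∣m∣n⇒∣m-n m∣a d)
    where e : ∀ a b → a - (a - b) ≡ b
          e = solve-∀

  inverse-unique : ∀ {u v} → u * v ≈ + 1 → v * v ≈ + 1 → u ≈ v
  inverse-unique {u} {v} uv≈1 vv≈1 = begin
    u              ≡⟨ ℤP.*-identityʳ u ⟨
    u * + 1        ≈⟨ *-congˡ u vv≈1 ⟨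
    u * (v * v)    ≡⟨ ℤP.*-assoc u v v ⟨
    u * v * v      ≈⟨ *-congʳ v uv≈1 ⟩
    + 1 * v        ≡⟨ ℤP.*-identityˡ v ⟩
    v              ∎
    where open ≈-Reasoning

  ∤-between : ∀ {k} → 0 ℕ.< k → k ℕ.< m → ¬ (+ m ℤ∣.∣ + k)
  ∤-between 0<k k<m = ℕ∣.>⇒∤ {{ℕ.>-nonZero 0<k}} k<m ∘ ℤ∣.∣⇒∣ᵤ

  private
    ≥-≈⇒≡ : ∀ {u v} → v ℕ.≤ u → u ℕ.< m → + u ≈ + v → u ≡ v
    ≥-≈⇒≡ {u} {v} v≤u u<m (mk≈ m∣u-v) with u ℕ.∸ v in u∸v≡
    ... | zero  = ℕP.≤-antisym (ℕP.m∸n≡0⇒m≤n u∸v≡) v≤u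
    ... | suc d = contradiction m∣1+d (∤-between (ℕ.s≤s ℕ.z≤n) 1+d<m)
      where m∣1+d = subst (+ m ℤ∣.∣_) (trans (ℤP.m-n≡m⊖n u v) (trans (ℤP.⊖-≥ v≤u) (cong +_ u∸v≡))) m∣u-v
            1+d<m = subst (ℕ._< m) u∸v≡ (ℕP.≤-<-trans (ℕP.m∸n≤m u v) u<m)

  ≈⇒≡ : ∀ {u v} → u ℕ.< m → v ℕ.< m → + u ≈ + v → u ≡ v
  ≈⇒≡ {u} {v} u<m v<m u≈v with ℕP.≤-total v u
  ... | inj₁ v≤u = ≥-≈⇒≡ v≤u u<m u≈v
  ... | inj₂ u≤v = sym (≥-≈⇒≡ u≤v v<m (≈-sym u≈v))

  divides?⇒≈ : ∀ {x y} → T (divides? m (x - y)) → x ≈ y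
  divides?⇒≈ {x} {y} t with m ℕ∣.∣? ∣ x - y ∣
  ... | yes m∣x-y = mk≈ (ℤ∣.∣ᵤ⇒∣ m∣x-y)

  ≈⇒divides? : ∀ {x y} → x ≈ y → T (divides? m (x - y))
  ≈⇒divides? {x} {y} (mk≈ m∣x-y) = subst T (sym (dec-true (m ℕ∣.∣? ∣ x - y ∣) (ℤ∣.∣⇒∣ᵤ m∣x-y))) _

  record Pairing (σ : ℕ → ℕ) (c : ℤ) (xs : List ℕ) : Set where
    field
      closed           : ∀ {x} → x ∈ xs → σ x ∈ xs
      fixed-point-free : ∀ {x} → x ∈ xs → σ x ≢ x
      involutive       : ∀ {x} → x ∈ xs → σ (σ x) ≡ x
      pair-product     : ∀ {x} → x ∈ xs → + x * + σ x ≈ c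

  module _ {σ : ℕ → ℕ} {c : ℤ} where

    remove-pair : ∀ {x xs} → Unique (x ∷ xs) → Pairing σ c (x ∷ xs) →
                  xs ↭ σ x ∷ without (σ x) xs × Unique (without (σ x) xs) × Pairing σ c (without (σ x) xs)
    remove-pair {x} {xs} (x∉xs ∷ u) P = ↭-without u σx∈xs , filter⁺ _ u , record
      { closed           = closed′
      ; fixed-point-free = fixed-point-free ∘ inherited
      ; involutive       = involutive ∘ inherited
      ; pair-product     = pair-product ∘ inherited
      }
      where
        open Pairing P
        ∈-tail : ∀ {z} → z ∈ x ∷ xs → z ≢ x → z ∈ xs
        ∈-tail (here z≡x)  z≢x = contradiction z≡x z≢x
        ∈-tail (there z∈xs) _  = z∈xs
        σx∈xs : σ x ∈ xs
        σx∈xs = ∈-tail (closed (here refl)) (fixed-point-free (here refl))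
        inherited : ∀ {z} → z ∈ without (σ x) xs → z ∈ x ∷ xs
        inherited = there ∘ proj₁ ∘ ∈-without⁻ xs
        closed′ : ∀ {z} → z ∈ without (σ x) xs → σ z ∈ without (σ x) xs
        closed′ {z} z∈ = ∈-without⁺ (∈-tail (closed (inherited z∈)) σz≢x) σz≢σx
          where
            z≢σx = proj₂ (∈-without⁻ xs z∈)
            σz≢x : σ z ≢ x
            σz≢x σz≡x = z≢σx (trans (sym (involutive (inherited z∈))) (cong σ σz≡x))
            σz≢σx : σ z ≢ σ x
            σz≢σx σz≡σx = All.lookup x∉xs (proj₁ (∈-without⁻ xs z∈))
              (sym (trans (sym (involutive (inherited z∈))) (trans (cong σ σz≡σx) (involutive (here refl)))))

    pairing-product : ∀ {xs} → Unique xs → Pairing σ c xs → ∃ λ k → length xs ≡ 2 ℕ.* k × + product xs ≈ c ^ k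
    pairing-product {xs} = go xs (<-wellFounded (length xs))
      where
        go : ∀ xs → Acc ℕ._<_ (length xs) → Unique xs → Pairing σ c xs →
             ∃ λ k → length xs ≡ 2 ℕ.* k × + product xs ≈ c ^ k
        go []       _        _ _ = 0 , refl , ≈-refl
        go (x ∷ xs) (acc rs) u P with remove-pair u P
        ... | xs↭ , u′ , P′ with go (without (σ x) xs) (rs shorter) u′ P′
          where shorter = ℕP.m≤n⇒m≤1+n (ℕP.≤-reflexive (sym (↭-length xs↭)))
        ... | k , len , prod = suc k , len′ , prod′
          where
            open ≈-Reasoning
            ys = without (σ x) xs
            len′ : suc (length xs) ≡ 2 ℕ.* suc k
            len′ = trans (cong suc (trans (↭-length xs↭) (cong suc len))) (sym (ℕP.*-suc 2 k))
            prod′ : + (x ℕ.* product xs) ≈ c ^ suc k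
            prod′ = begin
              + (x ℕ.* product xs)               ≡⟨ cong (λ n → + (x ℕ.* n)) (product-↭ xs↭) ⟩
              + (x ℕ.* (σ x ℕ.* product ys))     ≡⟨ cong +_ (ℕP.*-assoc x (σ x) (product ys)) ⟨
              + (x ℕ.* σ x ℕ.* product ys)       ≡⟨ trans (ℤP.pos-* (x ℕ.* σ x) _) (cong (_* + product ys) (ℤP.pos-* x (σ x))) ⟩
              + x * + σ x * + product ys         ≈⟨ *-cong (Pairing.pair-product P (here refl)) prod ⟩
              c * c ^ k                          ∎

module Runs (n : ℕ) where

  m : ℕ
  m = suc n

  open Congruence m

  skip : ℤ → ℤ
  skip x = if divides? m x then + 1 else x

  skip-∣ : ∀ x → + m ℤ∣.∣ x → skip x ≡ + 1
  skip-∣ x m∣x = cong (λ b → if b then + 1 else x) (dec-true (m ℕ∣.∣? ∣ x ∣) (ℤ∣.∣⇒∣ᵤ m∣x))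

  skip-∤ : ∀ x → ¬ (+ m ℤ∣.∣ x) → skip x ≡ x
  skip-∤ x m∤x = cong (λ b → if b then + 1 else x) (dec-false (m ℕ∣.∣? ∣ x ∣) (m∤x ∘ ℤ∣.∣ᵤ⇒∣))

  skip-cong : ∀ {a b} → a ≈ b → skip a ≈ skip b
  skip-cong {a} {b} a≈b with + m ℤ∣.∣? a
  ... | yes m∣a = ≈-reflexive (trans (skip-∣ a m∣a) (sym (skip-∣ b (≈-resp-∣ a≈b m∣a))))
  ... | no  m∤a = ≈-trans (≈-reflexive (skip-∤ a m∤a))
                          (≈-trans a≈b (≈-reflexive (sym (skip-∤ b (m∤a ∘ ≈-resp-∣ (≈-sym a≈b))))))

  run : ℤ → ℕ → ℤ
  run a k = ∏ k (λ i → skip (a + + i))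

  run-suc : ∀ a → run (a + + 1) m ≈ run a m
  run-suc a = begin
    ∏ n (λ i → skip (a + + 1 + + i)) * skip (a + + 1 + + m)
      ≈⟨ *-cong (≈-reflexive (∏-cong n (λ i _ → cong skip (shift i)))) (skip-cong period) ⟩
    ∏ n (λ i → skip (a + + suc i)) * skip (a + + 1)
      ≈⟨ ≈-reflexive (ℤP.*-comm _ (skip (a + + 1))) ⟩
    skip (a + + 1) * ∏ n (λ i → skip (a + + suc i))
      ≈⟨ ≈-reflexive (∏-suc n (λ i → skip (a + + i))) ⟨
    run a m ∎
    where
      open ≈-Reasoning
      shift : ∀ i → a + + 1 + + suc i ≡ a + + suc (suc i)
      shift i = ℤP.+-assoc a (+ 1) (+ suc i)
      period : a + + 1 + + m ≈ a + + 1
      period = ≈-trans (≈-reflexive (cong (λ z → a + + 1 + z) (sym (ℤP.*-identityˡ (+ m)))))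
                       (+-multiple (a + + 1) (+ 1))

  run-0 : run (+ 0) m ≈ + (n !)
  run-0 = ≈-reflexive (begin
    ∏ n (λ i → skip (+ i)) * skip (+ m)
      ≡⟨ cong₂ _*_ (∏-cong n (λ i i<n → skip-∤ (+ suc i) (∤-between (ℕ.s≤s ℕ.z≤n) (ℕ.s≤s i<n))))
                   (skip-∣ (+ m) ℤ∣.∣-refl) ⟩
    ∏ n (λ i → + i) * + 1
      ≡⟨ ℤP.*-identityʳ _ ⟩
    ∏ n (λ i → + i)
      ≡⟨ ∏-id n ⟩
    + (n !) ∎)
    where open ≡-Reasoning

  run-≈-! : ∀ a → run a m ≈ + (n !)
  run-≈-! (+ zero)        = run-0
  run-≈-! (+ suc k)       = ≈-trans (≈-reflexive (cong (λ z → run (+ z) m) (ℕP.+-comm 1 k)))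
                                    (≈-trans (run-suc (+ k)) (run-≈-! (+ k)))
  run-≈-! -[1+ zero ]     = ≈-trans (≈-sym (run-suc -[1+ 0 ])) run-0
  run-≈-! -[1+ suc k ]    = ≈-trans (≈-sym (run-suc -[1+ suc k ])) (run-≈-! -[1+ k ])

module OddPrime (h : ℕ) (p-prime : Prime (suc (2 ℕ.* h))) where

  p : ℕ
  p = suc (2 ℕ.* h)

  open Congruence p

  euclid : ∀ a b → + p ℤ∣.∣ a * b → + p ℤ∣.∣ a ⊎ + p ℤ∣.∣ b
  euclid a b p∣ab with euclidsLemma ∣ a ∣ ∣ b ∣ p-prime (subst (p ℕ∣.∣_) (ℤP.abs-* a b) (ℤ∣.∣⇒∣ᵤ p∣ab))
  ... | inj₁ p∣a = inj₁ (ℤ∣.∣ᵤ⇒∣ p∣a)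
  ... | inj₂ p∣b = inj₂ (ℤ∣.∣ᵤ⇒∣ p∣b)

  *-cancelˡ-≈ : ∀ {c u v} → ¬ (+ p ℤ∣.∣ c) → c * u ≈ c * v → u ≈ v
  *-cancelˡ-≈ {c} {u} {v} p∤c (mk≈ p∣cu-cv) with euclid c (u - v) (subst (+ p ℤ∣.∣_) (e c u v) p∣cu-cv)
    where e : ∀ c u v → c * u - c * v ≡ c * (u - v)
          e = solve-∀
  ... | inj₁ p∣c   = contradiction p∣c p∤c
  ... | inj₂ p∣u-v = mk≈ p∣u-v

  square-≈ : ∀ x y → x * x ≈ y * y → x ≈ y ⊎ x ≈ - y
  square-≈ x y (mk≈ p∣x²-y²) with euclid (x - y) (x + y) (subst (+ p ℤ∣.∣_) (e x y) p∣x²-y²)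
    where e : ∀ x y → x * x - y * y ≡ (x - y) * (x + y)
          e = solve-∀
  ... | inj₁ p∣x-y = inj₁ (mk≈ p∣x-y)
  ... | inj₂ p∣x+y = inj₂ (mk≈ (subst (+ p ℤ∣.∣_) (cong (λ z → x + z) (sym (ℤP.neg-involutive y))) p∣x+y))

  residue : ℤ → ℕ
  residue z = z ℤ.%ℕ p

  ≈-residue : ∀ z → z ≈ + residue z
  ≈-residue z = ≈-trans (≈-reflexive (a≡a%ℕn+[a/ℕn]*n z p)) (+-multiple (+ residue z) (z ℤ./ℕ p))

  -- A Bézout coefficient of x modulo p: an inverse of x only when 0 < x < p.
  inverse : ℕ → ℤ
  inverse x with Bézout.lemma p x
  ... | Bézout.result _ _ (Bézout.+- _ y _) = - + y
  ... | Bézout.result _ _ (Bézout.-+ _ y _) = + y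

  private
    Bézout-ℤ : ∀ a b c d → 1 ℕ.+ a ℕ.* b ≡ c ℕ.* d → + 1 + + a * + b ≡ + c * + d
    Bézout-ℤ a b c d eq = trans (cong (λ z → + 1 + z) (sym (ℤP.pos-* a b))) (trans (cong +_ eq) (ℤP.pos-* c d))

  *-inverse : ∀ {x} → 0 ℕ.< x → x ℕ.< p → + x * inverse x ≈ + 1
  *-inverse {x} 0<x x<p with Bézout.lemma p x
  ... | Bézout.result d gcd identity
    with GCD.unique gcd (coprime⇒GCD≡1 (prime⇒coprime p-prime {{ℕ.>-nonZero 0<x}} x<p))
  ... | refl with identity
  ... | Bézout.+- a y eq = ≈-trans (≈-reflexive (begin
    + x * - + y                      ≡⟨ e (+ x) (+ y) ⟩
    + 1 + - (+ 1 + + y * + x)        ≡⟨ cong (λ t → + 1 + - t) (Bézout-ℤ y x a p eq) ⟩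
    + 1 + - (+ a * + p)              ≡⟨ cong (λ t → + 1 + t) (ℤP.neg-distribˡ-* (+ a) (+ p)) ⟩
    + 1 + - + a * + p                ∎)) (+-multiple (+ 1) (- + a))
    where open ≡-Reasoning
          e : ∀ x y → x * - y ≡ + 1 + - (+ 1 + y * x)
          e = solve-∀
  ... | Bézout.-+ a y eq =
    ≈-trans (≈-reflexive (trans (ℤP.*-comm (+ x) (+ y)) (sym (Bézout-ℤ a p y x eq)))) (+-multiple (+ 1) (+ a))

  units : List ℕ
  units = applyDownFrom suc (2 ℕ.* h)

  ∈-units⁺ : ∀ {x} → 0 ℕ.< x → x ℕ.< p → x ∈ units
  ∈-units⁺ {suc x} _ (ℕ.s≤s x<2h) = ∈-applyDownFrom⁺ suc x<2h

  ∈-units⁻ : ∀ {x} → x ∈ units → 0 ℕ.< x × x ℕ.< p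
  ∈-units⁻ x∈ with ∈-applyDownFrom⁻ suc x∈
  ... | _ , i<2h , refl = ℕ.s≤s ℕ.z≤n , ℕ.s≤s i<2h

  units-unique : Unique units
  units-unique = applyDownFrom⁺₁ suc (2 ℕ.* h) (λ j<i _ eq → ℕP.<-irrefl (sym (ℕP.suc-injective eq)) j<i)

  ∤-unit : ∀ {x} → x ∈ units → ¬ (+ p ℤ∣.∣ + x)
  ∤-unit x∈ = ∤-between (proj₁ (∈-units⁻ x∈)) (proj₂ (∈-units⁻ x∈))

  ≈⇒≡-unit : ∀ {z w} → z ∈ units → w ∈ units → + z ≈ + w → z ≡ w
  ≈⇒≡-unit z∈ w∈ = ≈⇒≡ (proj₂ (∈-units⁻ z∈)) (proj₂ (∈-units⁻ w∈))

  *-cancelʳ-unit : ∀ {w z z′} → w ∈ units → z ℕ.< p → z′ ℕ.< p → + z * + w ≈ + z′ * + w → z ≡ z′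
  *-cancelʳ-unit {w} {z} {z′} w∈ z<p z′<p zw≈z′w =
    ≈⇒≡ z<p z′<p (*-cancelˡ-≈ (∤-unit w∈) (≈-trans (≈-reflexive (ℤP.*-comm (+ w) (+ z)))
                                          (≈-trans zw≈z′w (≈-reflexive (ℤP.*-comm (+ z′) (+ w))))))

  negate-unit : ∀ {x} → x ∈ units → p ℕ.∸ x ∈ units × + (p ℕ.∸ x) ≈ - + x
  negate-unit {x} x∈ with ∈-units⁻ x∈
  ... | 0<x , x<p = ∈-units⁺ (ℕP.m<n⇒0<n∸m x<p) (ℕP.∸-monoʳ-< 0<x (ℕP.<⇒≤ x<p)) , (begin
    + (p ℕ.∸ x)
      ≡⟨ e (+ (p ℕ.∸ x)) (+ x) ⟩
    - + x + + 1 * (+ (p ℕ.∸ x) + + x)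
      ≡⟨ cong (λ t → - + x + + 1 * t) (trans (sym (ℤP.pos-+ (p ℕ.∸ x) x)) (cong +_ (ℕP.m∸n+n≡m (ℕP.<⇒≤ x<p)))) ⟩
    - + x + + 1 * + p
      ≈⟨ +-multiple (- + x) (+ 1) ⟩
    - + x ∎)
    where open ≈-Reasoning
          e : ∀ y x → y ≡ - x + + 1 * (y + x)
          e = solve-∀

  negate-unit-≢ : ∀ {x} → x ∈ units → p ℕ.∸ x ≢ x
  negate-unit-≢ {x} x∈ p∸x≡x = ℕP.even≢odd x h (begin
    2 ℕ.* x           ≡⟨ cong (x ℕ.+_) (ℕP.+-identityʳ x) ⟩
    x ℕ.+ x           ≡⟨ cong (ℕ._+ x) p∸x≡x ⟨
    p ℕ.∸ x ℕ.+ x     ≡⟨ ℕP.m∸n+n≡m (ℕP.<⇒≤ (proj₂ (∈-units⁻ x∈))) ⟩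
    p                 ∎)
    where open ≡-Reasoning

  product-units : product units ≡ (2 ℕ.* h) !
  product-units = product-applyDownFrom-suc (2 ℕ.* h)

  module Partner (a : ℤ) (p∤a : ¬ (+ p ℤ∣.∣ a)) where

    partner : ℕ → ℕ
    partner x = residue (a * inverse x)

    partner-product : ∀ {x} → x ∈ units → + x * + partner x ≈ a
    partner-product {x} x∈ = begin
      + x * + partner x          ≈⟨ *-congˡ (+ x) (≈-residue (a * inverse x)) ⟨
      + x * (a * inverse x)      ≡⟨ e (+ x) a (inverse x) ⟩
      a * (+ x * inverse x)      ≈⟨ *-congˡ a (*-inverse (proj₁ (∈-units⁻ x∈)) (proj₂ (∈-units⁻ x∈))) ⟩
      a * + 1                    ≡⟨ ℤP.*-identityʳ a ⟩
      a                          ∎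
      where open ≈-Reasoning
            e : ∀ x a i → x * (a * i) ≡ a * (x * i)
            e = solve-∀

    partner-∈ : ∀ {x} → x ∈ units → partner x ∈ units
    partner-∈ {x} x∈ with partner x in eq
    ... | zero  = contradiction (≈-resp-∣ (≈-trans (≈-reflexive (sym (ℤP.*-zeroʳ (+ x))))
                                                   (subst (λ s → + x * + s ≈ a) eq (partner-product x∈)))
                                          (divides (+ 0) refl)) p∤a
    ... | suc y = ∈-units⁺ (ℕ.s≤s ℕ.z≤n) (subst (ℕ._< p) eq (n%ℕd<d (a * inverse x) p))

    partner-involutive : ∀ {x} → x ∈ units → partner (partner x) ≡ x
    partner-involutive {x} x∈ =
      *-cancelʳ-unit (partner-∈ x∈) (n%ℕd<d (a * inverse (partner x)) p) (proj₂ (∈-units⁻ x∈))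
        (≈-trans (≈-reflexive (ℤP.*-comm (+ partner (partner x)) (+ partner x)))
                 (≈-trans (partner-product (partner-∈ x∈)) (≈-sym (partner-product x∈))))

    partner-of-root : ∀ {z w} → z ∈ units → w ∈ units → + w * + w ≈ a → partner z ≡ w → z ≡ w
    partner-of-root {z} {w} z∈ w∈ w²≈a refl =
      *-cancelʳ-unit w∈ (proj₂ (∈-units⁻ z∈)) (proj₂ (∈-units⁻ w∈)) (≈-trans (partner-product z∈) (≈-sym w²≈a))

    product-units-nonresidue : (∀ {x} → x ∈ units → ¬ (+ x * + x ≈ a)) → + ((2 ℕ.* h) !) ≈ a ^ h
    product-units-nonresidue nonsquare with pairing-product units-unique pairing
      where
        pairing : Pairing partner a units
        pairing = record
          { closed           = partner-∈
          ; fixed-point-free = λ {x} x∈ σx≡x → nonsquare x∈ (subst (λ s → + x * + s ≈ a) σx≡x (partner-product x∈))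
          ; involutive       = partner-involutive
          ; pair-product     = partner-product
          }
    ... | k , len , prod = subst₂ (λ n j → + n ≈ a ^ j) product-units
                                  (ℕP.*-cancelˡ-≡ k h 2 (trans (sym len) (length-applyDownFrom suc (2 ℕ.* h)))) prod


    -- The fixed points of partner are the square roots x₀ and p ∸ x₀ of a; the other units still pair up.
    module Residue {x₀ : ℕ} (x₀∈ : x₀ ∈ units) (x₀²≈a : + x₀ * + x₀ ≈ a) where

      y₀ : ℕ
      y₀ = p ℕ.∸ x₀

      y₀∈ : y₀ ∈ units
      y₀∈ = proj₁ (negate-unit x₀∈)

      y₀≈-x₀ : + y₀ ≈ - + x₀
      y₀≈-x₀ = proj₂ (negate-unit x₀∈)

      y₀²≈a : + y₀ * + y₀ ≈ a
      y₀²≈a = ≈-trans (*-cong y₀≈-x₀ y₀≈-x₀) (≈-trans (≈-reflexive (e (+ x₀))) x₀²≈a)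
        where e : ∀ x → - x * - x ≡ x * x
              e = solve-∀

      rest : List ℕ
      rest = without y₀ (without x₀ units)

      rest-unique : Unique rest
      rest-unique = filter⁺ _ (filter⁺ _ units-unique)

      ∈-rest⁻ : ∀ {z} → z ∈ rest → z ∈ units × z ≢ x₀ × z ≢ y₀
      ∈-rest⁻ z∈ with ∈-without⁻ (without x₀ units) z∈
      ... | z∈′ , z≢y₀ with ∈-without⁻ units z∈′
      ... | z∈units , z≢x₀ = z∈units , z≢x₀ , z≢y₀

      units↭ : units ↭ x₀ ∷ y₀ ∷ rest
      units↭ = ↭-trans (↭-without units-unique x₀∈)
                       (↭-prep x₀ (↭-without (filter⁺ _ units-unique) (∈-without⁺ y₀∈ (negate-unit-≢ x₀∈))))

      rest-pairing : Pairing partner a rest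
      rest-pairing = record
        { closed           = closed
        ; fixed-point-free = fixed-point-free
        ; involutive       = partner-involutive ∘ proj₁ ∘ ∈-rest⁻
        ; pair-product     = partner-product ∘ proj₁ ∘ ∈-rest⁻
        }
        where
          closed : ∀ {z} → z ∈ rest → partner z ∈ rest
          closed z∈ with ∈-rest⁻ z∈
          ... | z∈units , z≢x₀ , z≢y₀ =
            ∈-without⁺ (∈-without⁺ (partner-∈ z∈units) (z≢x₀ ∘ partner-of-root z∈units x₀∈ x₀²≈a))
                       (z≢y₀ ∘ partner-of-root z∈units y₀∈ y₀²≈a)
          fixed-point-free : ∀ {z} → z ∈ rest → partner z ≢ z
          fixed-point-free {z} z∈ σz≡z with ∈-rest⁻ z∈
          ... | z∈units , z≢x₀ , z≢y₀ =
            [ z≢x₀ ∘ ≈⇒≡-unit z∈units x₀∈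
            , (λ z≈-x₀ → z≢y₀ (≈⇒≡-unit z∈units y₀∈ (≈-trans z≈-x₀ (≈-sym y₀≈-x₀))))
            ]′ (square-≈ (+ z) (+ x₀) (≈-trans z²≈a (≈-sym x₀²≈a)))
            where z²≈a = subst (λ s → + z * + s ≈ a) σz≡z (partner-product z∈units)

      product-units-residue : + ((2 ℕ.* h) !) ≈ - (a ^ h)
      product-units-residue with pairing-product rest-unique rest-pairing
      ... | k , len , prod = begin
        + ((2 ℕ.* h) !)                       ≡⟨ cong +_ (trans (sym product-units) (product-↭ units↭)) ⟩
        + (x₀ ℕ.* (y₀ ℕ.* product rest))      ≡⟨ trans (ℤP.pos-* x₀ _) (cong (+ x₀ *_) (ℤP.pos-* y₀ _)) ⟩
        + x₀ * (+ y₀ * + product rest)        ≈⟨ *-congˡ (+ x₀) (*-cong y₀≈-x₀ prod) ⟩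
        + x₀ * (- + x₀ * a ^ k)               ≡⟨ e (+ x₀) (a ^ k) ⟩
        - (+ x₀ * + x₀ * a ^ k)               ≈⟨ -‿cong (*-congʳ (a ^ k) x₀²≈a) ⟩
        - (a ^ suc k)                         ≡⟨ cong (λ j → - (a ^ j)) (ℕP.*-cancelˡ-≡ h (suc k) 2 2h≡2[1+k]) ⟨
        - (a ^ h)                             ∎
        where
          open ≈-Reasoning
          e : ∀ x t → x * (- x * t) ≡ - (x * x * t)
          e = solve-∀
          2h≡2[1+k] : 2 ℕ.* h ≡ 2 ℕ.* suc k
          2h≡2[1+k] = trans (sym (length-applyDownFrom suc (2 ℕ.* h)))
                            (trans (↭-length units↭) (trans (cong (suc ∘ suc) len) (sym (ℕP.*-suc 2 k))))

  0<h : 0 ℕ.< h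
  0<h = ℕP.n≢0⇒n>0 (λ h≡0 → ¬prime[1] (subst (λ n → Prime (suc (2 ℕ.* n))) h≡0 p-prime))

  1∈units : 1 ∈ units
  1∈units = ∈-units⁺ ℕP.≤-refl (ℕ.s≤s (ℕP.≤-trans 0<h (ℕP.m≤m+n h (h ℕ.+ 0))))

  wilson : + ((2 ℕ.* h) !) ≈ - + 1
  wilson = ≈-trans (Partner.Residue.product-units-residue (+ 1) (∤-unit 1∈units) 1∈units ≈-refl)
                   (≈-reflexive (cong -_ (ℤP.^-zeroˡ h)))

  legendre-unit : ∀ {a} → ¬ (+ p ℤ∣.∣ a) → legendre a p ≡ (if isSquareMod a p then + 1 else - + 1)
  legendre-unit {a} p∤a =
    cong (λ b → if b then + 0 else (if isSquareMod a p then + 1 else - + 1))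
         (dec-false (p ℕ∣.∣? ∣ a ∣) (p∤a ∘ ℤ∣.∣ᵤ⇒∣))

  legendre-±1 : ∀ {a} → ¬ (+ p ℤ∣.∣ a) → legendre a p ≡ + 1 ⊎ legendre a p ≡ - + 1
  legendre-±1 {a} p∤a rewrite legendre-unit p∤a with isSquareMod a p
  ... | true  = inj₁ refl
  ... | false = inj₂ refl

  euler-residue : ∀ {a} → ¬ (+ p ℤ∣.∣ a) → isSquareMod a p ≡ true → a ^ h ≈ + 1
  euler-residue {a} p∤a square? with find (any⁻ _ (upTo p) (subst T (sym square?) _))
  ... | x , x∈upTo , x²-a≡0 = begin
    a ^ h                    ≡⟨ ℤP.neg-involutive (a ^ h) ⟨
    - - (a ^ h)              ≈⟨ -‿cong (Partner.Residue.product-units-residue a p∤a x∈units x²≈a) ⟨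
    - + ((2 ℕ.* h) !)        ≈⟨ -‿cong wilson ⟩
    + 1                      ∎
    where
      open ≈-Reasoning
      x²≈a : + x * + x ≈ a
      x²≈a = divides?⇒≈ x²-a≡0
      x∈units : x ∈ units
      x∈units = ∈-units⁺ (ℕP.n≢0⇒n>0 (λ { refl → p∤a (≈-resp-∣ x²≈a (divides (+ 0) refl)) })) (∈-upTo⁻ x∈upTo)

  euler-nonresidue : ∀ {a} → ¬ (+ p ℤ∣.∣ a) → isSquareMod a p ≡ false → a ^ h ≈ - + 1
  euler-nonresidue {a} p∤a nonsquare? = ≈-trans (≈-sym (Partner.product-units-nonresidue a p∤a nonsquare)) wilson
    where
      nonsquare : ∀ {x} → x ∈ units → ¬ (+ x * + x ≈ a)
      nonsquare x∈ x²≈a = subst T nonsquare? (any⁺ _ (lose (∈-upTo⁺ (proj₂ (∈-units⁻ x∈))) (≈⇒divides? x²≈a)))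

  euler-criterion : ∀ {a} → ¬ (+ p ℤ∣.∣ a) → legendre a p ≈ a ^ h
  euler-criterion {a} p∤a rewrite legendre-unit p∤a with isSquareMod a p in square?
  ... | true  = ≈-sym (euler-residue p∤a square?)
  ... | false = ≈-sym (euler-nonresidue p∤a square?)

module Rows (h : ℕ) where

  p : ℕ
  p = suc (2 ℕ.* h)

  open Congruence p
  open Runs (2 ℕ.* h) using (skip; skip-∤; run; run-≈-!)

  [2h]! : ℤ
  [2h]! = + ((2 ℕ.* h) !)

  -- Definitionally, rowP i and rowM i are the i-th rows of the two prodCoprime products of LHS61 and RHS61.
  rowP : ℕ → ℤ
  rowP i = ∏ h (λ j → skip (+ (2 ℕ.* i) + + j))

  rowM : ℕ → ℤ
  rowM i = ∏ h (λ j → skip (+ (2 ℕ.* i) - + j))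

  p≡h+[1+h] : p ≡ h ℕ.+ suc h
  p≡h+[1+h] = trans (cong suc (cong (h ℕ.+_) (ℕP.+-identityʳ h))) (sym (ℕP.+-suc h h))

  skip-2* : ∀ {i} → 1 ℕ.≤ i → i ℕ.≤ h → skip (+ (2 ℕ.* i)) ≡ + (2 ℕ.* i)
  skip-2* 1≤i i≤h = skip-∤ _ (∤-between (ℕP.≤-trans (ℕ.s≤s ℕ.z≤n) (ℕP.*-monoʳ-≤ 2 1≤i)) (ℕ.s≤s (ℕP.*-monoʳ-≤ 2 i≤h)))

  row-window : ∀ {i} → 1 ℕ.≤ i → i ℕ.≤ h → rowM i * rowP i * + (2 ℕ.* i) ≈ [2h]!
  row-window {i} 1≤i i≤h = begin
    rowM i * rowP i * + (2 ℕ.* i)                   ≡⟨ e (rowM i) (rowP i) (+ (2 ℕ.* i)) ⟩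
    rowM i * + (2 ℕ.* i) * rowP i                   ≡⟨ cong (λ z → rowM i * z * rowP i) (skip-2* 1≤i i≤h) ⟨
    rowM i * skip (+ (2 ℕ.* i)) * rowP i            ≡⟨ ∏-centred skip (+ (2 ℕ.* i)) h ⟨
    run (+ (2 ℕ.* i) - + suc h) (h ℕ.+ suc h)       ≡⟨ cong (run (+ (2 ℕ.* i) - + suc h)) p≡h+[1+h] ⟨
    run (+ (2 ℕ.* i) - + suc h) p                   ≈⟨ run-≈-! (+ (2 ℕ.* i) - + suc h) ⟩
    [2h]!                                           ∎
    where
      open ≈-Reasoning
      e : ∀ a b c → a * b * c ≡ a * c * b
      e = solve-∀

  left : ℤ
  left = + (h !!) * ∏ h rowP

  right : ℤ
  right = + ((h ℕ.∸ 1) !!) * ∏ h rowM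

  double-factorials : + (h !!) * + ((h ℕ.∸ 1) !!) ≡ + (h !)
  double-factorials = trans (sym (ℤP.pos-* (h !!) ((h ℕ.∸ 1) !!))) (cong +_ (n!!*[n∸1]!!≡n! h))

  left*right : left * right * (+ 2) ^ h ≈ [2h]! ^ h
  left*right = begin
    + (h !!) * P * (+ ((h ℕ.∸ 1) !!) * M) * (+ 2) ^ h       ≡⟨ e (+ (h !!)) P (+ ((h ℕ.∸ 1) !!)) M ((+ 2) ^ h) ⟩
    M * P * ((+ 2) ^ h * (+ (h !!) * + ((h ℕ.∸ 1) !!)))     ≡⟨ cong (λ z → M * P * ((+ 2) ^ h * z)) double-factorials ⟩
    M * P * ((+ 2) ^ h * + (h !))                           ≡⟨ cong (M * P *_) (∏2i≡2^n*n! h) ⟨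
    M * P * ∏ h (λ i → + (2 ℕ.* i))                         ≡⟨ cong (_* ∏ h (λ i → + (2 ℕ.* i))) (∏-* h rowM rowP) ⟨
    ∏ h (λ i → rowM i * rowP i) * ∏ h (λ i → + (2 ℕ.* i))   ≡⟨ ∏-* h (λ i → rowM i * rowP i) (λ i → + (2 ℕ.* i)) ⟨
    ∏ h (λ i → rowM i * rowP i * + (2 ℕ.* i))               ≈⟨ ∏-cong≈ h (λ k k<h → row-window (ℕ.s≤s ℕ.z≤n) k<h) ⟩
    ∏ h (λ _ → [2h]!)                                       ≡⟨ ∏-const h [2h]! ⟩
    [2h]! ^ h                                               ∎
    where
      open ≈-Reasoning
      P = ∏ h rowP
      M = ∏ h rowM
      e : ∀ a b c d t → a * b * (c * d) * t ≡ d * b * (t * (a * c))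
      e = solve-∀

  rowP-window : ∀ m {i} → h ≡ 2 ℕ.* m → 1 ℕ.≤ i → i ℕ.≤ h → rowP i * rowP (m ℕ.+ i) * + (2 ℕ.* i) ≈ [2h]!
  rowP-window m {i} h≡2m 1≤i i≤h = begin
    rowP i * rowP (m ℕ.+ i) * + (2 ℕ.* i)
      ≡⟨ e (rowP i) (rowP (m ℕ.+ i)) (+ (2 ℕ.* i)) ⟩
    + 1 * + (2 ℕ.* i) * (rowP i * rowP (m ℕ.+ i))
      ≡⟨ cong₂ (λ x y → + 1 * x * y) skip-centre halves ⟨
    + 1 * skip (a + + 1) * (run (a + + 1) h * run (a + + 1 + + h) h)
      ≡⟨ cong (+ 1 * skip (a + + 1) *_) (∏-shift-+ skip (a + + 1) h h) ⟨
    + 1 * skip (a + + 1) * run (a + + 1) (h ℕ.+ h)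
      ≡⟨ ∏-shift-+ skip a 1 (h ℕ.+ h) ⟨
    run a (1 ℕ.+ (h ℕ.+ h))
      ≡⟨ cong (λ n → run a (suc (h ℕ.+ n))) (ℕP.+-identityʳ h) ⟨
    run a p
      ≈⟨ run-≈-! a ⟩
    [2h]! ∎
    where
      open ≈-Reasoning
      a = + (2 ℕ.* i) - + 1
      e : ∀ x y z → x * y * z ≡ + 1 * z * (x * y)
      e = solve-∀
      a+1≡2i : a + + 1 ≡ + (2 ℕ.* i)
      a+1≡2i = r (+ (2 ℕ.* i))
        where r : ∀ t → t - + 1 + + 1 ≡ t
              r = solve-∀
      skip-centre : skip (a + + 1) ≡ + (2 ℕ.* i)
      skip-centre = trans (cong skip a+1≡2i) (skip-2* 1≤i i≤h)
      a+1+h≡2[m+i] : a + + 1 + + h ≡ + (2 ℕ.* (m ℕ.+ i))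
      a+1+h≡2[m+i] = trans (cong (_+ + h) a+1≡2i) (trans (sym (ℤP.pos-+ (2 ℕ.* i) h)) (cong +_ 2i+h≡2[m+i]))
        where 2i+h≡2[m+i] : 2 ℕ.* i ℕ.+ h ≡ 2 ℕ.* (m ℕ.+ i)
              2i+h≡2[m+i] = trans (cong (2 ℕ.* i ℕ.+_) h≡2m)
                                  (trans (ℕP.+-comm (2 ℕ.* i) (2 ℕ.* m)) (sym (ℕP.*-distribˡ-+ 2 m i)))
      halves : run (a + + 1) h * run (a + + 1 + + h) h ≡ rowP i * rowP (m ℕ.+ i)
      halves = cong₂ _*_ (cong (λ b → run b h) a+1≡2i) (cong (λ b → run b h) a+1+h≡2[m+i])

  left-even : ∀ m → h ≡ 2 ℕ.* m → left ≈ [2h]! ^ m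
  left-even m h≡2m = begin
    + (h !!) * ∏ h rowP
      ≡⟨ cong₂ (λ x n → + (x !!) * ∏ n rowP) h≡2m (trans h≡2m (cong (m ℕ.+_) (ℕP.+-identityʳ m))) ⟩
    + ((2 ℕ.* m) !!) * ∏ (m ℕ.+ m) rowP
      ≡⟨ cong₂ _*_ (∏2i≡[2n]!! m) (sym (∏-+ m m rowP)) ⟨
    E * (∏ m rowP * ∏ m (λ i → rowP (m ℕ.+ i)))
      ≡⟨ cong (E *_) (∏-* m rowP (λ i → rowP (m ℕ.+ i))) ⟨
    E * ∏ m (λ i → rowP i * rowP (m ℕ.+ i))
      ≡⟨ ℤP.*-comm E _ ⟩
    ∏ m (λ i → rowP i * rowP (m ℕ.+ i)) * E
      ≡⟨ ∏-* m (λ i → rowP i * rowP (m ℕ.+ i)) (λ i → + (2 ℕ.* i)) ⟨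
    ∏ m (λ i → rowP i * rowP (m ℕ.+ i) * + (2 ℕ.* i))
      ≈⟨ ∏-cong≈ m (λ k k<m → rowP-window m h≡2m (ℕ.s≤s ℕ.z≤n) (ℕP.≤-trans k<m m≤h)) ⟩
    ∏ m (λ _ → [2h]!)
      ≡⟨ ∏-const m [2h]! ⟩
    [2h]! ^ m ∎
    where
      open ≈-Reasoning
      E = ∏ m (λ i → + (2 ℕ.* i))
      m≤h : m ℕ.≤ h
      m≤h = subst (m ℕ.≤_) (sym h≡2m) (ℕP.m≤n*m m 2)

  rowP-0 : rowP 0 ≡ + (h !)
  rowP-0 = trans (∏-cong h (λ k k<h → skip-∤ (+ suc k) (∤-between (ℕ.s≤s ℕ.z≤n) (ℕ.s≤s (k<2h k<h))))) (∏-id h)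
    where k<2h : ∀ {k} → k ℕ.< h → k ℕ.< 2 ℕ.* h
          k<2h k<h = ℕP.≤-trans k<h (ℕP.m≤m+n h (h ℕ.+ 0))

  rowM-reflect : ∀ m → h ≡ suc (2 ℕ.* m) → ∀ i → rowM (m ℕ.+ suc i) ≡ rowP i
  rowM-reflect m h≡1+2m i =
    trans (∏-cong h (λ j _ → cong (λ t → skip (t - + suc j)) centre)) (∏-reflect skip (+ (2 ℕ.* i)) h)
    where
      centre : + (2 ℕ.* (m ℕ.+ suc i)) ≡ + (2 ℕ.* i) + + suc h
      centre = trans (cong +_ (trans (e m i) (cong (λ n → 2 ℕ.* i ℕ.+ suc n) (sym h≡1+2m))))
                     (ℤP.pos-+ (2 ℕ.* i) (suc h))
        where e : ∀ m i → 2 ℕ.* (m ℕ.+ suc i) ≡ 2 ℕ.* i ℕ.+ suc (suc (2 ℕ.* m))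
              e = ℕ-solve-∀

  right-odd : ∀ m → h ≡ suc (2 ℕ.* m) → right ≈ [2h]! ^ m * + (h !)
  right-odd m h≡1+2m = begin
    + ((h ℕ.∸ 1) !!) * ∏ h rowM
      ≡⟨ cong₂ (λ x n → + (x !!) * ∏ n rowM) (cong (ℕ._∸ 1) h≡1+2m) h≡m+[1+m] ⟩
    + ((2 ℕ.* m) !!) * ∏ (m ℕ.+ suc m) rowM
      ≡⟨ cong₂ _*_ (∏2i≡[2n]!! m) (sym (∏-+ m (suc m) rowM)) ⟨
    E * (∏ m rowM * ∏ (suc m) (λ k → rowM (m ℕ.+ k)))
      ≡⟨ cong (λ z → E * (∏ m rowM * z)) (∏-suc m (λ k → rowM (m ℕ.+ k))) ⟩
    E * (∏ m rowM * (rowM (m ℕ.+ 1) * ∏ m (λ k → rowM (m ℕ.+ suc k))))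
      ≡⟨ cong₂ (λ x y → E * (∏ m rowM * (x * y))) middle (∏-cong m (λ k _ → rowM-reflect m h≡1+2m (suc k))) ⟩
    E * (∏ m rowM * (+ (h !) * ∏ m rowP))
      ≡⟨ e E (∏ m rowM) (+ (h !)) (∏ m rowP) ⟩
    ∏ m rowM * ∏ m rowP * E * + (h !)
      ≡⟨ cong (λ z → z * E * + (h !)) (∏-* m rowM rowP) ⟨
    ∏ m (λ i → rowM i * rowP i) * E * + (h !)
      ≡⟨ cong (_* + (h !)) (∏-* m (λ i → rowM i * rowP i) (λ i → + (2 ℕ.* i))) ⟨
    ∏ m (λ i → rowM i * rowP i * + (2 ℕ.* i)) * + (h !)
      ≈⟨ *-congʳ (+ (h !)) (∏-cong≈ m (λ k k<m → row-window (ℕ.s≤s ℕ.z≤n) (ℕP.≤-trans k<m m≤h))) ⟩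
    ∏ m (λ _ → [2h]!) * + (h !)
      ≡⟨ cong (_* + (h !)) (∏-const m [2h]!) ⟩
    [2h]! ^ m * + (h !) ∎
    where
      open ≈-Reasoning
      E = ∏ m (λ i → + (2 ℕ.* i))
      h≡m+[1+m] : h ≡ m ℕ.+ suc m
      h≡m+[1+m] = trans h≡1+2m (trans (cong suc (cong (m ℕ.+_) (ℕP.+-identityʳ m))) (sym (ℕP.+-suc m m)))
      m≤h : m ℕ.≤ h
      m≤h = subst (m ℕ.≤_) (sym h≡m+[1+m]) (ℕP.m≤m+n m (suc m))
      middle : rowM (m ℕ.+ 1) ≡ + (h !)
      middle = trans (rowM-reflect m h≡1+2m 0) rowP-0
      e : ∀ a b c d → a * (b * (c * d)) ≡ b * d * a * c
      e = solve-∀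

  [2h]!≈±h!² : [2h]! ≈ (- + 1) ^ h * (+ (h !) * + (h !))
  [2h]!≈±h!² = begin
    + ((2 ℕ.* h) !)                                  ≡⟨ trans (cong (λ n → + (n !)) 2h≡h+h) (sym (∏-id (h ℕ.+ h))) ⟩
    ∏ (h ℕ.+ h) (λ k → + k)                          ≡⟨ ∏-+ h h (λ k → + k) ⟩
    ∏ h (λ k → + k) * ∏ h (λ k → + (h ℕ.+ k))        ≡⟨ cong₂ _*_ (∏-id h) (∏-reverse h (λ k → + (h ℕ.+ k))) ⟩
    + (h !) * ∏ h (λ k → + (h ℕ.+ (suc h ℕ.∸ k)))    ≈⟨ *-congˡ (+ (h !)) (∏-cong≈ h upper≈-lower) ⟩
    + (h !) * ∏ h (λ k → - + 1 * + k)                ≡⟨ cong (+ (h !) *_) (∏-* h (λ _ → - + 1) (λ k → + k)) ⟩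
    + (h !) * (∏ h (λ _ → - + 1) * ∏ h (λ k → + k))  ≡⟨ cong₂ (λ x y → + (h !) * (x * y)) (∏-const h (- + 1)) (∏-id h) ⟩
    + (h !) * ((- + 1) ^ h * + (h !))                ≡⟨ e (+ (h !)) ((- + 1) ^ h) ⟩
    (- + 1) ^ h * (+ (h !) * + (h !))                ∎
    where
      open ≈-Reasoning
      2h≡h+h : 2 ℕ.* h ≡ h ℕ.+ h
      2h≡h+h = cong (h ℕ.+_) (ℕP.+-identityʳ h)
      e : ∀ f s → f * (s * f) ≡ s * (f * f)
      e = solve-∀
      upper≈-lower : ∀ k → k ℕ.< h → + (h ℕ.+ (h ℕ.∸ k)) ≈ - + 1 * + suc k
      upper≈-lower k k<h = begin
        + (h ℕ.+ (h ℕ.∸ k))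
          ≡⟨ r (+ (h ℕ.+ (h ℕ.∸ k))) (+ suc k) ⟩
        - + suc k + + 1 * (+ (h ℕ.+ (h ℕ.∸ k)) + + suc k)
          ≡⟨ cong (λ t → - + suc k + + 1 * t) (trans (sym (ℤP.pos-+ _ (suc k))) (cong +_ sum≡p)) ⟩
        - + suc k + + 1 * + p
          ≈⟨ +-multiple (- + suc k) (+ 1) ⟩
        - + suc k
          ≡⟨ ℤP.-1*i≡-i (+ suc k) ⟨
        - + 1 * + suc k ∎
        where
          r : ∀ a k → a ≡ - k + + 1 * (a + k)
          r = solve-∀
          sum≡p : h ℕ.+ (h ℕ.∸ k) ℕ.+ suc k ≡ p
          sum≡p = trans (ℕP.+-suc _ k) (cong suc (trans (ℕP.+-assoc h (h ℕ.∸ k) k)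
                          (trans (cong (h ℕ.+_) (ℕP.m∸n+n≡m (ℕP.<⇒≤ k<h))) (sym 2h≡h+h))))

module Lemma6·1 (h : ℕ) (p-prime : Prime (suc (2 ℕ.* h))) where

  open OddPrime h p-prime using (p; 0<h; wilson; euler-criterion; legendre-±1; square-≈)
  open Rows h hiding (p)
  open Congruence p

  ℓ : ℤ
  ℓ = legendre (- + 2) p

  p∤-2 : ¬ (+ p ℤ∣.∣ - + 2)
  p∤-2 = ∤-between (ℕ.s≤s ℕ.z≤n) (ℕ.s≤s (ℕP.*-monoʳ-≤ 2 0<h)) ∘ ℤ∣.∣m⇒∣-m

  ℓ*ℓ≡1 : ℓ * ℓ ≡ + 1
  ℓ*ℓ≡1 with legendre-±1 p∤-2
  ... | inj₁ ℓ≡1  rewrite ℓ≡1  = refl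
  ... | inj₂ ℓ≡-1 rewrite ℓ≡-1 = refl

  [2h]!^m² : ∀ m → [2h]! ^ m * [2h]! ^ m ≈ + 1
  [2h]!^m² m = ≈-trans (*-cong (^-congˡ m wilson) (^-congˡ m wilson)) (≈-reflexive ([-1]^n*[-1]^n≡1 m))

  left*ℓright≈1 : left * (ℓ * right) ≈ + 1
  left*ℓright≈1 = begin
    left * (ℓ * right)                        ≡⟨ e left ℓ right ⟩
    left * right * ℓ                          ≈⟨ *-congˡ (left * right) (euler-criterion p∤-2) ⟩
    left * right * (- + 1 * + 2) ^ h          ≡⟨ cong (left * right *_) (^-distribʳ-* (- + 1) (+ 2) h) ⟩
    left * right * ((- + 1) ^ h * (+ 2) ^ h)  ≡⟨ e′ (left * right) ((- + 1) ^ h) ((+ 2) ^ h) ⟩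
    left * right * (+ 2) ^ h * (- + 1) ^ h    ≈⟨ *-congʳ ((- + 1) ^ h) left*right ⟩
    [2h]! ^ h * (- + 1) ^ h                   ≈⟨ *-congʳ ((- + 1) ^ h) (^-congˡ h wilson) ⟩
    (- + 1) ^ h * (- + 1) ^ h                 ≡⟨ [-1]^n*[-1]^n≡1 h ⟩
    + 1                                       ∎
    where
      open ≈-Reasoning
      e : ∀ l s r → l * (s * r) ≡ l * r * s
      e = solve-∀
      e′ : ∀ a b c → a * (b * c) ≡ a * c * b
      e′ = solve-∀

  h!²≈[-1]^[1+h] : + (h !) * + (h !) ≈ (- + 1) ^ suc h
  h!²≈[-1]^[1+h] = begin
    + (h !) * + (h !)                                   ≡⟨ e ((- + 1) ^ h) (+ (h !) * + (h !)) ([-1]^n*[-1]^n≡1 h) ⟩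
    (- + 1) ^ h * ((- + 1) ^ h * (+ (h !) * + (h !)))   ≈⟨ *-congˡ ((- + 1) ^ h) [2h]!≈±h!² ⟨
    (- + 1) ^ h * [2h]!                                 ≈⟨ *-congˡ ((- + 1) ^ h) wilson ⟩
    (- + 1) ^ h * - + 1                                 ≡⟨ ℤP.*-comm ((- + 1) ^ h) (- + 1) ⟩
    (- + 1) ^ suc h                                     ∎
    where
      open ≈-Reasoning
      e : ∀ s x → s * s ≡ + 1 → x ≡ s * (s * x)
      e s x s²≡1 = trans (sym (ℤP.*-identityˡ x)) (trans (cong (_* x) (sym s²≡1)) (ℤP.*-assoc s s x))

  left²≈1⊎right²≈1 : left * left ≈ + 1 ⊎ right * right ≈ + 1
  left²≈1⊎right²≈1 with even-or-odd h
  ... | m , inj₁ h≡2m   = inj₁ (≈-trans (*-cong (left-even m h≡2m) (left-even m h≡2m)) ([2h]!^m² m))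
  ... | m , inj₂ h≡1+2m = inj₂ (begin
    right * right                                   ≈⟨ *-cong (right-odd m h≡1+2m) (right-odd m h≡1+2m) ⟩
    [2h]! ^ m * + (h !) * ([2h]! ^ m * + (h !))     ≡⟨ e ([2h]! ^ m) (+ (h !)) ⟩
    [2h]! ^ m * [2h]! ^ m * (+ (h !) * + (h !))     ≈⟨ *-cong ([2h]!^m² m) h!²≈[-1]^[1+h] ⟩
    + 1 * (- + 1) ^ suc h
      ≡⟨ trans (ℤP.*-identityˡ _) (trans (cong ((- + 1) ^_) 1+h≡2[1+m]) ([-1]^2n≡1 (suc m))) ⟩
    + 1                                             ∎)
    where
      open ≈-Reasoning
      e : ∀ w f → w * f * (w * f) ≡ w * w * (f * f)
      e = solve-∀
      1+h≡2[1+m] : suc h ≡ 2 ℕ.* suc m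
      1+h≡2[1+m] = trans (cong suc h≡1+2m) (sym (ℕP.*-suc 2 m))

  ℓright²≡right² : ℓ * right * (ℓ * right) ≡ right * right
  ℓright²≡right² = trans (e ℓ right) (trans (cong (_* (right * right)) ℓ*ℓ≡1) (ℤP.*-identityˡ (right * right)))
    where e : ∀ l r → l * r * (l * r) ≡ l * l * (r * r)
          e = solve-∀

  left≈ℓright : left ≈ ℓ * right
  left≈ℓright with left²≈1⊎right²≈1
  ... | inj₁ left²≈1  =
    ≈-sym (inverse-unique (≈-trans (≈-reflexive (ℤP.*-comm (ℓ * right) left)) left*ℓright≈1) left²≈1)
  ... | inj₂ right²≈1 = inverse-unique left*ℓright≈1 (≈-trans (≈-reflexive ℓright²≡right²) right²≈1)

  ℓright²≈1 : ℓ * right * (ℓ * right) ≈ + 1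
  ℓright²≈1 = ≈-trans (*-congʳ (ℓ * right) (≈-sym left≈ℓright)) left*ℓright≈1

  [2h]/2≡h : (2 ℕ.* h) ℕ./ 2 ≡ h
  [2h]/2≡h = trans (cong (ℕ._/ 2) (ℕP.*-comm 2 h)) (m*n/n≡m h 2)

  [2h∸2]/2≡h∸1 : (2 ℕ.* h ℕ.∸ 2) ℕ./ 2 ≡ h ℕ.∸ 1
  [2h∸2]/2≡h∸1 = trans (cong (ℕ._/ 2) (trans (sym (ℕP.*-distribˡ-∸ 2 h 1)) (ℕP.*-comm 2 (h ℕ.∸ 1))))
                       (m*n/n≡m (h ℕ.∸ 1) 2)

  LHS61≡left : LHS61 p ≡ left
  LHS61≡left = cong (λ n → + (n !!) * prodCoprime p n (λ i j → + (2 ℕ.* i) + + j)) [2h]/2≡h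

  RHS61≡ℓright : RHS61 p ≡ ℓ * right
  RHS61≡ℓright =
    trans (cong₂ (λ n k → ℓ * + (k !!) * prodCoprime p n (λ i j → + (2 ℕ.* i) - + j)) [2h]/2≡h [2h∸2]/2≡h∸1)
          (ℤP.*-assoc ℓ (+ ((h ℕ.∸ 1) !!)) (∏ h rowM))

  LHS61≈RHS61 : LHS61 p ≈ RHS61 p
  LHS61≈RHS61 = subst₂ _≈_ (sym LHS61≡left) (sym RHS61≡ℓright) left≈ℓright

  RHS61≈±1 : RHS61 p ≈ + 1 ⊎ RHS61 p ≈ - + 1
  RHS61≈±1 = subst (λ r → r ≈ + 1 ⊎ r ≈ - + 1) (sym RHS61≡ℓright) (square-≈ (ℓ * right) (+ 1) ℓright²≈1)

prime>3⇒odd : ∀ p → Prime p → p > 3 → ∃ λ h → p ≡ suc (2 ℕ.* h)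
prime>3⇒odd p p-prime p>3 with even-or-odd p
... | h , inj₂ p≡1+2h = h , p≡1+2h
... | h , inj₁ p≡2h with prime⇒irreducible p-prime (ℕ∣.divides h (trans p≡2h (ℕP.*-comm 2 h)))
...   | inj₁ ()
...   | inj₂ 2≡p = contradiction (subst (3 ℕ.<_) (sym 2≡p) p>3) (λ { (ℕ.s≤s (ℕ.s≤s ())) })

lemma6p1 : (p : ℕ) → Prime p → p > 3 →
    (LHS61 p ≡ RHS61 p [mod p ]) × ((RHS61 p ≡ + 1 [mod p ]) ⊎ (RHS61 p ≡ - (+ 1) [mod p ]))
lemma6p1 p p-prime p>3 with prime>3⇒odd p p-prime p>3
... | h , refl = ≈⇒≡[mod] LHS61≈RHS61 , [ inj₁ ∘ ≈⇒≡[mod] , inj₂ ∘ ≈⇒≡[mod] ]′ RHS61≈±1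
  where open Lemma6·1 h p-prime
        open Congruence p
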